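{- Let $r\ge1$ and let $k\in\{2,3,4\}$. For each $j=1,\ldots,r$ let $n_j$ be a positive integer divisible by $3$ and let $(T^{(j)}_0,T^{(j)}_1,T^{(j)}_2,T^{(j)}_3)$ be an equitable partition of $Q_{n_j}$ with quotient matrix $S^{(4)}_{n_j}$. Let $(C_i)_{i=0}^{k-1}$ be an equitable partition of the Hamming graph $H(r,4)$ with quotient matrix $S^{(k)}_{3r}$. Put $N=n_1+\cdots+n_r$ and $$C'_i=\bigcup_{(v_1,\ldots,v_r)\in C_i} T^{(1)}_{v_1}\times\cdots\times T^{(r)}_{v_r}\subseteq\{0,1\}^N,\qquad i=0,\ldots,k-1.$$ Then $(C'_i)_{i=0}^{k-1}$ is an equitable partition of $Q_N$ with quotient matrix $S^{(k)}_N$.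
   Context: $Q_m$ is the graph on $\{0,1\}^m$ with two words adjacent iff they differ in exactly one position. $H(r,4)$ is the graph on $\{0,1,2,3\}^r$ with two words adjacent iff they differ in exactly one position. A partition $(C_i)$ of the vertices of a graph is equitable with quotient matrix $(S_{i,j})$ if every vertex of $C_i$ has exactly $S_{i,j}$ neighbours in $C_j$. For $m$ divisible by $3$ and $s=m/3$: $S^{(2)}_m=\begin{pmatrix}0&3s\\ s&2s\end{pmatrix}$, $S^{(3)}_m=\begin{pmatrix}0&s&2s\\ s&0&2s\\ s&s&s\end{pmatrix}$, and $S^{(4)}_m$ is the $4\times4$ matrix with $0$ on the diagonal and $s$ in every off-diagonal entry. -}

module Defs where

open import Data.Nat using (ℕ; zero; suc; _+_; _*_; _/_)
open import Data.Fin using (Fin; zero; suc)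
open import Data.Fin.Properties using (_≟_)
open import Data.Vec using (Vec; []; _∷_; lookup; take; drop)
import Data.Vec as Vec
open import Data.List using (List; [_]; map; concatMap; filter; length)
open import Data.List.Base using (allFin)
open import Data.Product using (_×_)
open import Relation.Nullary using (does)
open import Relation.Nullary.Decidable using (_×-dec_)
open import Data.Bool using (if_then_else_)
import Data.Nat.Properties as ℕP
open import Relation.Binary.PropositionalEquality using (_≡_)

-- Words of length n over the alphabet Fin q: the vertex set of the
-- Hamming graph H(n,q).  Q_m is H(m,2) (binary alphabet {0,1} = Fin 2).
Word : ℕ → ℕ → Set
Word n q = Vec (Fin q) n

allWords : (n q : ℕ) → List (Word n q)
allWords zero    q = [ [] ]
allWords (suc n) q = concatMap (λ a → map (a ∷_) (allWords n q)) (allFin q)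

dist : ∀ {n q} → Word n q → Word n q → ℕ
dist []       []       = 0
dist (a ∷ u) (b ∷ v) = (if does (a ≟ b) then 0 else 1) + dist u v

nbrsIn : ∀ {n q k} → (Word n q → Fin k) → Word n q → Fin k → ℕ
nbrsIn {n} {q} c v j =
  length (filter (λ w → (dist v w ℕP.≟ 1) ×-dec (c w ≟ j)) (allWords n q))

IsEquitable : (n q k : ℕ) → (Word n q → Fin k) → (Fin k → Fin k → ℕ) → Set
IsEquitable n q k c S = ∀ (i j : Fin k) (v : Word n q) → c v ≡ i → nbrsIn c v j ≡ S i j

S2 : ℕ → Fin 2 → Fin 2 → ℕ
S2 m zero       zero       = 0
S2 m zero       (suc zero) = 3 * (m / 3)
S2 m (suc zero) zero       = m / 3
S2 m (suc zero) (suc zero) = 2 * (m / 3)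

S3 : ℕ → Fin 3 → Fin 3 → ℕ
S3 m zero             zero             = 0
S3 m zero             (suc zero)       = m / 3
S3 m zero             (suc (suc zero)) = 2 * (m / 3)
S3 m (suc zero)       zero             = m / 3
S3 m (suc zero)       (suc zero)       = 0
S3 m (suc zero)       (suc (suc zero)) = 2 * (m / 3)
S3 m (suc (suc zero)) zero             = m / 3
S3 m (suc (suc zero)) (suc zero)       = m / 3
S3 m (suc (suc zero)) (suc (suc zero)) = m / 3

S4 : ℕ → Fin 4 → Fin 4 → ℕ
S4 m i j = if does (i ≟ j) then 0 else m / 3

-- S^(k)_m for k ∈ {2,3,4} (other k are never used: the theorem assumes k ∈ {2,3,4}).
Smat : (k : ℕ) → ℕ → Fin k → Fin k → ℕ
Smat 2 = S2
Smat 3 = S3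
Smat 4 = S4
Smat _ = λ _ _ _ → 0

block : ∀ {A : Set} {r} (ns : Vec ℕ r) → Vec A (Vec.sum ns) → (j : Fin r) → Vec A (lookup ns j)
block (n ∷ ns) xs zero    = take n xs
block (n ∷ ns) xs (suc j) = block ns (drop n xs) j

-- The construction C'_i = ⋃_{(v_1..v_r) ∈ C_i} T^(1)_{v_1} × ... × T^(r)_{v_r},
-- given by its class map: x ∈ {0,1}^N lies in C'_i iff the tuple of
-- T-classes of its blocks lies in C_i.
liftPartition : ∀ {r k} (ns : Vec ℕ r) →
  ((j : Fin r) → Word (lookup ns j) 2 → Fin 4) →
  (Word r 4 → Fin k) → Word (Vec.sum ns) 2 → Fin k
liftPartition ns T C x = C (Vec.tabulate (λ j → T j (block ns x j)))

module Submission where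

-- A neighbour of x in Q_N differs from x inside a single block j, so only the j-th block
-- class v_j of x can change. Since T^(j) has quotient matrix (n_j/3)(J − I), the number of
-- neighbours of x in C'_l is the sum over j of (n_j/3)·c_j(v,l), where c_j(v,l) counts the
-- neighbours of v in H(r,4) that differ from v in coordinate j and lie in C_l.
-- Equitability of C only says that the c_j(v,l) sum to r·S_3(i,l); the point is that each
-- of them already equals S_3(i,l). For a column l of S_3 that is 0 on the diagonal and 1
-- elsewhere, the class C_l is independent and so meets every line {v[j≔b] : b} (a clique)
-- at most once, which gives c_j(v,l) ≤ S_3(i,l) and hence equality. The one remaining
-- column of S^(2) and S^(3) then follows from the row sums Σ_l c_j(v,l) = 3. Altogether
-- x has S_3(i,l)·N/3 = S_N(i,l) neighbours in C'_l.

open import Defs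
open import Data.Bool using (Bool; true; false; _∧_; if_then_else_)
open import Data.Nat using (ℕ; zero; suc; _+_; _*_; _∸_; _/_; _≤_; _<_; _≡ᵇ_; NonZero; z≤n)
open import Data.Nat.Properties
  using ( +-assoc; +-identityʳ; *-assoc; *-comm; *-identityˡ; *-identityʳ; *-zeroʳ; *-distribʳ-+
        ; +-cancelˡ-≡; +-cancelʳ-≡; +-cancelʳ-≤; +-mono-≤; +-monoʳ-≤; ≤-antisym; ≤-reflexive
        ; m+n≡0⇒m≡0; m+n≡0⇒n≡0; 1+n≢0; +-*-semiring; *-commutativeSemigroup)
open import Data.Nat.DivMod using (+-distrib-/-∣ˡ; 0/n≡0; m*n/n≡m)
import Data.Nat.ListAction as List using (sum)
open import Data.Nat.ListAction.Properties using (sum-++)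
open import Data.Nat.Divisibility using (_∣_)
open import Data.Fin using (Fin; zero; suc)
open import Data.Fin.Properties using (_≟_; suc-injective)
open import Data.Vec using (Vec; []; _∷_; lookup; sum; _++_; _[_]≔_; take; drop; splitAt; tabulate)
open import Data.Vec.Properties using ([]≔-lookup; []≔-idempotent; lookup∘update)
open import Data.List using (List; []; _∷_; map; concatMap; filter; length; allFin) renaming (tabulate to tabulateᴸ)
open import Data.List.Properties using (map-concatMap; map-tabulate; map-cong; map-∘)
open import Data.Product using (∃-syntax; _,_)
open import Data.Sum using (_⊎_; inj₁; inj₂)
open import Data.Empty using (⊥-elim)
open import Function using (_∘_; id)
open import Relation.Nullary using (does; yes; no)
open import Relation.Nullary.Decidable using (dec-true)
open import Relation.Unary using (Pred; Decidable)
open import Relation.Binary.PropositionalEquality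
  using (_≡_; _≢_; refl; sym; trans; cong; cong₂; subst; module ≡-Reasoning)
open import Algebra.Properties.CommutativeSemigroup *-commutativeSemigroup using (xy∙z≈xz∙y)
open import Algebra.Properties.Semiring.Sum +-*-semiring
  using (sum-syntax; sum-cong-≗; sum-replicate-zero; ∑-distrib-+; ∑-comm; *-distribˡ-sum; *-distribʳ-sum)

⟦_⟧ : Bool → ℕ
⟦ true  ⟧ = 1
⟦ false ⟧ = 0

⟦∧⟧ : ∀ x y → ⟦ x ∧ y ⟧ ≡ ⟦ x ⟧ * ⟦ y ⟧
⟦∧⟧ true  y = sym (+-identityʳ ⟦ y ⟧)
⟦∧⟧ false y = refl

letterDist : ∀ {q} → Fin q → Fin q → ℕ
letterDist a b = if does (a ≟ b) then 0 else 1

letterDist-refl : ∀ {q} (a : Fin q) → letterDist a a ≡ 0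
letterDist-refl a with a ≟ a
... | yes _  = refl
... | no a≢a = ⊥-elim (a≢a refl)

letterDist-≢ : ∀ {q} {a b : Fin q} → a ≢ b → letterDist a b ≡ 1
letterDist-≢ {a = a} {b} a≢b with a ≟ b
... | yes a≡b = ⊥-elim (a≢b a≡b)
... | no _    = refl

letterDist-+-⟦≟⟧ : ∀ {q} (a b : Fin q) x → letterDist a b * x + ⟦ does (a ≟ b) ⟧ * x ≡ x
letterDist-+-⟦≟⟧ a b x with a ≟ b
... | yes _ = +-identityʳ x
... | no _  = trans (+-identityʳ _) (+-identityʳ x)

∑-zero : ∀ {n} (f : Fin n → ℕ) → (∀ i → f i ≡ 0) → ∑[ i < n ] f i ≡ 0
∑-zero {n} f f≡0 = trans (sum-cong-≗ f≡0) (sum-replicate-zero n)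

∑≡0⇒≡0 : ∀ {n} (f : Fin n → ℕ) → ∑[ i < n ] f i ≡ 0 → ∀ i → f i ≡ 0
∑≡0⇒≡0 f ∑≡0 zero    = m+n≡0⇒m≡0 (f zero) ∑≡0
∑≡0⇒≡0 f ∑≡0 (suc i) = ∑≡0⇒≡0 (f ∘ suc) (m+n≡0⇒n≡0 (f zero) ∑≡0) i

∑-select : ∀ {n} (a : Fin n) (f : Fin n → ℕ) → ∑[ b < n ] (⟦ does (a ≟ b) ⟧ * f b) ≡ f a
∑-select {suc n} zero    f =
  trans (cong₂ _+_ (*-identityˡ (f zero)) (sum-replicate-zero n)) (+-identityʳ (f zero))
∑-select         (suc a) f = ∑-select a (f ∘ suc)

∑-letterDist : ∀ {n} (a : Fin n) → ∑[ b < n ] letterDist a b ≡ n ∸ 1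
∑-letterDist {suc n}       zero    = ∑-one n
  where
  ∑-one : ∀ n → ∑[ b < n ] 1 ≡ n
  ∑-one zero    = refl
  ∑-one (suc n) = cong suc (∑-one n)
∑-letterDist {suc (suc n)} (suc a) = cong suc (∑-letterDist a)

∑-⟦≟⟧ : ∀ {n} (a : Fin n) → ∑[ b < n ] ⟦ does (a ≟ b) ⟧ ≡ 1
∑-⟦≟⟧ {n} a = trans (sum-cong-≗ (λ b → sym (*-identityʳ ⟦ does (a ≟ b) ⟧))) (∑-select a (λ _ → 1))

∑-⟦⟧≤1 : ∀ {n p} {P : Pred (Fin n) p} (P? : Decidable P) →
         (∀ a b → P a → P b → a ≡ b) → ∑[ a < n ] ⟦ does (P? a) ⟧ ≤ 1
∑-⟦⟧≤1 {zero}  P? unique = z≤n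
∑-⟦⟧≤1 {suc n} P? unique with P? zero
... | yes P0 = ≤-reflexive (cong suc (∑-zero _ others))
  where
  others : ∀ b → ⟦ does (P? (suc b)) ⟧ ≡ 0
  others b with P? (suc b)
  ... | yes Pb with () ← unique zero (suc b) P0 Pb
  ... | no _   = refl
... | no _   = ∑-⟦⟧≤1 (P? ∘ suc) (λ a b Pa Pb → suc-injective (unique (suc a) (suc b) Pa Pb))

∑-≤-* : ∀ {n} (f : Fin n → ℕ) c → (∀ i → f i ≤ c) → ∑[ i < n ] f i ≤ n * c
∑-≤-* {zero}  f c f≤c = z≤n
∑-≤-* {suc n} f c f≤c = +-mono-≤ (f≤c zero) (∑-≤-* (f ∘ suc) c (f≤c ∘ suc))

+-tightˡ : ∀ {a b c d} → a ≤ c → b ≤ d → a + b ≡ c + d → a ≡ c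
+-tightˡ {a} {b} {c} {d} a≤c b≤d a+b≡c+d =
  ≤-antisym a≤c (+-cancelʳ-≤ d c a (subst (_≤ a + d) a+b≡c+d (+-monoʳ-≤ a b≤d)))

∑-tight : ∀ {n} (f : Fin n → ℕ) c → (∀ i → f i ≤ c) → ∑[ i < n ] f i ≡ n * c → ∀ i → f i ≡ c
∑-tight {suc n} f c f≤c ∑≡ = λ where
    zero    → f₀≡c
    (suc i) → ∑-tight (f ∘ suc) c (f≤c ∘ suc) (+-cancelˡ-≡ c _ _ (trans (cong (_+ _) (sym f₀≡c)) ∑≡)) i
  where
  f₀≡c : f zero ≡ c
  f₀≡c = +-tightˡ (f≤c zero) (∑-≤-* (f ∘ suc) c (f≤c ∘ suc)) ∑≡

∑-determines-entry : ∀ {n} (f g : Fin n → ℕ) (i₀ : Fin n) →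
  (∀ i → i ≢ i₀ → f i ≡ g i) → ∑[ i < n ] f i ≡ ∑[ i < n ] g i → f i₀ ≡ g i₀
∑-determines-entry f g zero    f≡g ∑≡ =
  +-cancelʳ-≡ _ (f zero) (g zero) (trans ∑≡ (cong (g zero +_) (sum-cong-≗ (λ i → sym (f≡g (suc i) λ ())))))
∑-determines-entry f g (suc i₀) f≡g ∑≡ =
  ∑-determines-entry (f ∘ suc) (g ∘ suc) i₀ (λ i i≢i₀ → f≡g (suc i) (i≢i₀ ∘ suc-injective))
    (+-cancelˡ-≡ (f zero) _ _ (trans ∑≡ (cong (_+ _) (sym (f≡g zero λ ())))))

∑W : (n q : ℕ) → (Word n q → ℕ) → ℕ
∑W zero    q f = f []
∑W (suc n) q f = ∑[ a < q ] ∑W n q (f ∘ (a ∷_))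

module _ {q : ℕ} where

  ∑W-cong : ∀ n {f g : Word n q → ℕ} → (∀ w → f w ≡ g w) → ∑W n q f ≡ ∑W n q g
  ∑W-cong zero    f≡g = f≡g []
  ∑W-cong (suc n) f≡g = sum-cong-≗ (λ a → ∑W-cong n (f≡g ∘ (a ∷_)))

  ∑W-distrib-+ : ∀ n (f g : Word n q → ℕ) → ∑W n q (λ w → f w + g w) ≡ ∑W n q f + ∑W n q g
  ∑W-distrib-+ zero    f g = refl
  ∑W-distrib-+ (suc n) f g = trans (sum-cong-≗ (λ a → ∑W-distrib-+ n (f ∘ (a ∷_)) (g ∘ (a ∷_))))
                                   (∑-distrib-+ (λ a → ∑W n q (f ∘ (a ∷_))) (λ a → ∑W n q (g ∘ (a ∷_))))

  *-distribˡ-∑W : ∀ n x (f : Word n q → ℕ) → x * ∑W n q f ≡ ∑W n q (λ w → x * f w)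
  *-distribˡ-∑W zero    x f = refl
  *-distribˡ-∑W (suc n) x f = trans (*-distribˡ-sum x (λ a → ∑W n q (f ∘ (a ∷_))))
                                    (sum-cong-≗ (λ a → *-distribˡ-∑W n x (f ∘ (a ∷_))))

  *-distribʳ-∑W : ∀ n x (f : Word n q → ℕ) → ∑W n q f * x ≡ ∑W n q (λ w → f w * x)
  *-distribʳ-∑W n x f = trans (*-comm _ x) (trans (*-distribˡ-∑W n x f) (∑W-cong n (λ w → *-comm x (f w))))

  ∑W-comm : ∀ n {k} (f : Word n q → Fin k → ℕ) →
            ∑W n q (λ w → ∑[ b < k ] f w b) ≡ ∑[ b < k ] ∑W n q (λ w → f w b)
  ∑W-comm zero    f = refl
  ∑W-comm (suc n) f = trans (sum-cong-≗ (λ a → ∑W-comm n (f ∘ (a ∷_))))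
                            (∑-comm (λ a b → ∑W n q (λ w → f (a ∷ w) b)))

  ∑W-++ : ∀ m {n} (f : Word (m + n) q → ℕ) →
          ∑W (m + n) q f ≡ ∑W m q (λ y → ∑W n q (λ z → f (y ++ z)))
  ∑W-++ zero    f = refl
  ∑W-++ (suc m) f = sum-cong-≗ (λ a → ∑W-++ m (f ∘ (a ∷_)))

length-filter≡sum : ∀ {a p} {A : Set a} {P : Pred A p} (P? : Decidable P) (xs : List A) →
  length (filter P? xs) ≡ List.sum (map (λ x → ⟦ does (P? x) ⟧) xs)
length-filter≡sum P? []       = refl
length-filter≡sum P? (x ∷ xs) with does (P? x)
... | true  = cong suc (length-filter≡sum P? xs)
... | false = length-filter≡sum P? xs

sum-concatMap : ∀ {a} {A : Set a} (f : A → List ℕ) (xs : List A) →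
  List.sum (concatMap f xs) ≡ List.sum (map (List.sum ∘ f) xs)
sum-concatMap f []       = refl
sum-concatMap f (x ∷ xs) = trans (sum-++ (f x) (concatMap f xs)) (cong (List.sum (f x) +_) (sum-concatMap f xs))

sum-map-allFin : ∀ q (f : Fin q → ℕ) → List.sum (map f (allFin q)) ≡ ∑[ a < q ] f a
sum-map-allFin q f = trans (cong List.sum (map-tabulate id f)) (sum-tabulate f)
  where
  sum-tabulate : ∀ {n} (f : Fin n → ℕ) → List.sum (tabulateᴸ f) ≡ ∑[ a < n ] f a
  sum-tabulate {zero}  f = refl
  sum-tabulate {suc n} f = cong (f zero +_) (sum-tabulate (f ∘ suc))

sum-map-allWords : ∀ n q (f : Word n q → ℕ) → List.sum (map f (allWords n q)) ≡ ∑W n q f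
sum-map-allWords zero    q f = +-identityʳ (f [])
sum-map-allWords (suc n) q f = begin
  List.sum (map f (concatMap (λ a → map (a ∷_) (allWords n q)) (allFin q)))
    ≡⟨ cong List.sum (map-concatMap f _ (allFin q)) ⟩
  List.sum (concatMap (λ a → map f (map (a ∷_) (allWords n q))) (allFin q))
    ≡⟨ sum-concatMap _ (allFin q) ⟩
  List.sum (map (λ a → List.sum (map f (map (a ∷_) (allWords n q)))) (allFin q))
    ≡⟨ cong List.sum (map-cong (λ a → trans (cong List.sum (sym (map-∘ (allWords n q))))
                                            (sum-map-allWords n q (f ∘ (a ∷_)))) (allFin q)) ⟩
  List.sum (map (λ a → ∑W n q (f ∘ (a ∷_))) (allFin q))
    ≡⟨ sum-map-allFin q _ ⟩
  ∑W (suc n) q f ∎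
  where open ≡-Reasoning

count-allWords : ∀ {n q p} {P : Pred (Word n q) p} (P? : Decidable P) →
  length (filter P? (allWords n q)) ≡ ∑W n q (λ w → ⟦ does (P? w) ⟧)
count-allWords {n} {q} P? = trans (length-filter≡sum P? (allWords n q)) (sum-map-allWords n q _)

nbrSum : ∀ {n q} → Word n q → (Word n q → ℕ) → ℕ
nbrSum {n} {q} v f = ∑W n q (λ w → ⟦ dist v w ≡ᵇ 1 ⟧ * f w)

nbrsIn≡nbrSum : ∀ {n q k} (c : Word n q → Fin k) v j → nbrsIn c v j ≡ nbrSum v (λ w → ⟦ does (c w ≟ j) ⟧)
nbrsIn≡nbrSum {n} {q} c v j =
  trans (count-allWords {n} {q} _) (∑W-cong n (λ w → ⟦∧⟧ (dist v w ≡ᵇ 1) (does (c w ≟ j))))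

nbrSum-cong : ∀ {n q} (v : Word n q) {f g : Word n q → ℕ} → (∀ w → f w ≡ g w) → nbrSum v f ≡ nbrSum v g
nbrSum-cong {n} v f≡g = ∑W-cong n (λ w → cong (⟦ dist v w ≡ᵇ 1 ⟧ *_) (f≡g w))

nbrSum-∘ : ∀ {n q k} (c : Word n q → Fin k) (h : Fin k → ℕ) v →
  nbrSum v (h ∘ c) ≡ ∑[ b < k ] (nbrsIn c v b * h b)
nbrSum-∘ {n} {q} {k} c h v = begin
  nbrSum v (h ∘ c)
    ≡⟨ ∑W-cong n (λ w → cong (adj w *_) (sym (∑-select (c w) h))) ⟩
  ∑W n q (λ w → adj w * ∑[ b < k ] (⟦ does (c w ≟ b) ⟧ * h b))
    ≡⟨ ∑W-cong n (λ w → *-distribˡ-sum (adj w) (λ b → ⟦ does (c w ≟ b) ⟧ * h b)) ⟩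
  ∑W n q (λ w → ∑[ b < k ] (adj w * (⟦ does (c w ≟ b) ⟧ * h b)))
    ≡⟨ ∑W-comm n (λ w b → adj w * (⟦ does (c w ≟ b) ⟧ * h b)) ⟩
  ∑[ b < k ] ∑W n q (λ w → adj w * (⟦ does (c w ≟ b) ⟧ * h b))
    ≡⟨ sum-cong-≗ (λ b → trans (∑W-cong n (λ w → sym (*-assoc (adj w) _ (h b)))) (sym (*-distribʳ-∑W n (h b) _))) ⟩
  ∑[ b < k ] (nbrSum v (λ w → ⟦ does (c w ≟ b) ⟧) * h b)
    ≡⟨ sum-cong-≗ (λ b → cong (_* h b) (sym (nbrsIn≡nbrSum c v b))) ⟩
  ∑[ b < k ] (nbrsIn c v b * h b) ∎
  where
  open ≡-Reasoning
  adj : Word n q → ℕ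
  adj w = ⟦ dist v w ≡ᵇ 1 ⟧

∑W-dist≡0 : ∀ {n q} (z : Word n q) (f : Word n q → ℕ) → ∑W n q (λ w → ⟦ dist z w ≡ᵇ 0 ⟧ * f w) ≡ f z
∑W-dist≡0               []      f = +-identityʳ (f [])
∑W-dist≡0 {suc n} {q} (a ∷ u) f = begin
  ∑[ b < q ] ∑W n q (λ w → ⟦ letterDist a b + dist u w ≡ᵇ 0 ⟧ * f (b ∷ w))
    ≡⟨ sum-cong-≗ (λ b → trans (∑W-cong n (factor b)) (sym (*-distribˡ-∑W n ⟦ does (a ≟ b) ⟧ _))) ⟩
  ∑[ b < q ] (⟦ does (a ≟ b) ⟧ * ∑W n q (λ w → ⟦ dist u w ≡ᵇ 0 ⟧ * f (b ∷ w)))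
    ≡⟨ ∑-select a _ ⟩
  ∑W n q (λ w → ⟦ dist u w ≡ᵇ 0 ⟧ * f (a ∷ w))
    ≡⟨ ∑W-dist≡0 u (f ∘ (a ∷_)) ⟩
  f (a ∷ u) ∎
  where
  open ≡-Reasoning
  factor : ∀ b w → ⟦ letterDist a b + dist u w ≡ᵇ 0 ⟧ * f (b ∷ w) ≡
                   ⟦ does (a ≟ b) ⟧ * (⟦ dist u w ≡ᵇ 0 ⟧ * f (b ∷ w))
  factor b w with a ≟ b
  ... | yes _ = sym (+-identityʳ _)
  ... | no _  = refl

dist-++ : ∀ {m n q} (y y′ : Word m q) (z z′ : Word n q) → dist (y ++ z) (y′ ++ z′) ≡ dist y y′ + dist z z′
dist-++ []      []       z z′ = refl
dist-++ (a ∷ y) (b ∷ y′) z z′ = trans (cong (letterDist a b +_) (dist-++ y y′ z z′)) (sym (+-assoc (letterDist a b) _ _))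

⟦+≡ᵇ1⟧ : ∀ d e → ⟦ d + e ≡ᵇ 1 ⟧ ≡ ⟦ d ≡ᵇ 1 ⟧ * ⟦ e ≡ᵇ 0 ⟧ + ⟦ d ≡ᵇ 0 ⟧ * ⟦ e ≡ᵇ 1 ⟧
⟦+≡ᵇ1⟧ zero          zero          = refl
⟦+≡ᵇ1⟧ zero          (suc zero)    = refl
⟦+≡ᵇ1⟧ zero          (suc (suc e)) = refl
⟦+≡ᵇ1⟧ (suc zero)    zero          = refl
⟦+≡ᵇ1⟧ (suc zero)    (suc e)       = refl
⟦+≡ᵇ1⟧ (suc (suc d)) e             = refl

adjacent-++ : ∀ {m n q} (y y′ : Word m q) (z z′ : Word n q) →
  ⟦ dist (y ++ z) (y′ ++ z′) ≡ᵇ 1 ⟧ ≡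
  ⟦ dist y y′ ≡ᵇ 1 ⟧ * ⟦ dist z z′ ≡ᵇ 0 ⟧ + ⟦ dist y y′ ≡ᵇ 0 ⟧ * ⟦ dist z z′ ≡ᵇ 1 ⟧
adjacent-++ y y′ z z′ = trans (cong (λ d → ⟦ d ≡ᵇ 1 ⟧) (dist-++ y y′ z z′)) (⟦+≡ᵇ1⟧ (dist y y′) (dist z z′))

nbrSum-++ : ∀ {m n q} (y : Word m q) (z : Word n q) (f : Word (m + n) q → ℕ) →
  nbrSum (y ++ z) f ≡ nbrSum y (λ y′ → f (y′ ++ z)) + nbrSum z (λ z′ → f (y ++ z′))
nbrSum-++ {m} {n} {q} y z f = begin
  nbrSum (y ++ z) f
    ≡⟨ ∑W-++ m _ ⟩
  ∑W m q (λ y′ → ∑W n q (λ z′ → ⟦ dist (y ++ z) (y′ ++ z′) ≡ᵇ 1 ⟧ * f (y′ ++ z′)))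
    ≡⟨ ∑W-cong m inner ⟩
  ∑W m q (λ y′ → ⟦ dist y y′ ≡ᵇ 1 ⟧ * f (y′ ++ z) + ⟦ dist y y′ ≡ᵇ 0 ⟧ * nbrSum z (λ z′ → f (y′ ++ z′)))
    ≡⟨ ∑W-distrib-+ m _ _ ⟩
  nbrSum y (λ y′ → f (y′ ++ z)) + ∑W m q (λ y′ → ⟦ dist y y′ ≡ᵇ 0 ⟧ * nbrSum z (λ z′ → f (y′ ++ z′)))
    ≡⟨ cong (nbrSum y (λ y′ → f (y′ ++ z)) +_) (∑W-dist≡0 y _) ⟩
  nbrSum y (λ y′ → f (y′ ++ z)) + nbrSum z (λ z′ → f (y ++ z′)) ∎
  where
  open ≡-Reasoning
  distribute : ∀ a b c d x → (a * b + c * d) * x ≡ a * (b * x) + c * (d * x)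
  distribute a b c d x = trans (*-distribʳ-+ x (a * b) (c * d)) (cong₂ _+_ (*-assoc a b x) (*-assoc c d x))
  inner : ∀ y′ → ∑W n q (λ z′ → ⟦ dist (y ++ z) (y′ ++ z′) ≡ᵇ 1 ⟧ * f (y′ ++ z′)) ≡
    ⟦ dist y y′ ≡ᵇ 1 ⟧ * f (y′ ++ z) + ⟦ dist y y′ ≡ᵇ 0 ⟧ * nbrSum z (λ z′ → f (y′ ++ z′))
  inner y′ = begin
    ∑W n q (λ z′ → ⟦ dist (y ++ z) (y′ ++ z′) ≡ᵇ 1 ⟧ * f (y′ ++ z′))
      ≡⟨ ∑W-cong n (λ z′ → trans (cong (_* f (y′ ++ z′)) (adjacent-++ y y′ z z′)) (distribute A₁ _ A₀ _ _)) ⟩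
    ∑W n q (λ z′ → A₁ * (⟦ dist z z′ ≡ᵇ 0 ⟧ * f (y′ ++ z′)) + A₀ * (⟦ dist z z′ ≡ᵇ 1 ⟧ * f (y′ ++ z′)))
      ≡⟨ ∑W-distrib-+ n _ _ ⟩
    ∑W n q (λ z′ → A₁ * (⟦ dist z z′ ≡ᵇ 0 ⟧ * f (y′ ++ z′)))
      + ∑W n q (λ z′ → A₀ * (⟦ dist z z′ ≡ᵇ 1 ⟧ * f (y′ ++ z′)))
      ≡⟨ cong₂ _+_ (*-distribˡ-∑W n A₁ _) (*-distribˡ-∑W n A₀ _) ⟨
    A₁ * ∑W n q (λ z′ → ⟦ dist z z′ ≡ᵇ 0 ⟧ * f (y′ ++ z′)) + A₀ * nbrSum z (λ z′ → f (y′ ++ z′))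
      ≡⟨ cong (λ t → A₁ * t + A₀ * nbrSum z (λ z′ → f (y′ ++ z′))) (∑W-dist≡0 z _) ⟩
    A₁ * f (y′ ++ z) + A₀ * nbrSum z (λ z′ → f (y′ ++ z′)) ∎
    where
    A₁ A₀ : ℕ
    A₁ = ⟦ dist y y′ ≡ᵇ 1 ⟧
    A₀ = ⟦ dist y y′ ≡ᵇ 0 ⟧

posNbrSum : ∀ {r q} → Word r q → (Word r q → ℕ) → Fin r → ℕ
posNbrSum {q = q} v f p = ∑[ b < q ] (letterDist (lookup v p) b * f (v [ p ]≔ b))

nbrSum≡∑posNbrSum : ∀ {r q} (v : Word r q) (f : Word r q → ℕ) → nbrSum v f ≡ ∑[ p < r ] posNbrSum v f p
nbrSum≡∑posNbrSum []      f = refl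
nbrSum≡∑posNbrSum (a ∷ u) f = trans (nbrSum-++ (a ∷ []) u f)
  (cong₂ _+_ (sum-cong-≗ (λ b → cong (_* f (b ∷ u)) (⟦letterDist≡ᵇ1⟧ b))) (nbrSum≡∑posNbrSum u (f ∘ (a ∷_))))
  where
  ⟦letterDist≡ᵇ1⟧ : ∀ b → ⟦ letterDist a b + 0 ≡ᵇ 1 ⟧ ≡ letterDist a b
  ⟦letterDist≡ᵇ1⟧ b with a ≟ b
  ... | yes _ = refl
  ... | no _  = refl

take-++ : ∀ {A : Set} {m n} (y : Vec A m) (z : Vec A n) → take m (y ++ z) ≡ y
take-++ []      z = refl
take-++ (a ∷ y) z = cong (a ∷_) (take-++ y z)

drop-++ : ∀ {A : Set} {m n} (y : Vec A m) (z : Vec A n) → drop m (y ++ z) ≡ z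
drop-++ []      z = refl
drop-++ (a ∷ y) z = drop-++ y z

blockClasses : ∀ {r q a} (ns : Vec ℕ r) → ((j : Fin r) → Word (lookup ns j) q → Fin a) → Word (sum ns) q → Word r a
blockClasses ns T x = tabulate (λ j → T j (block ns x j))

blockClasses-++ : ∀ {r q a} n (ns : Vec ℕ r) (T : (j : Fin (suc r)) → Word (lookup (n ∷ ns) j) q → Fin a)
  (y : Word n q) (z : Word (sum ns) q) →
  blockClasses (n ∷ ns) T (y ++ z) ≡ T zero y ∷ blockClasses ns (T ∘ suc) z
blockClasses-++ n ns T y z = cong₂ _∷_ (cong (T zero) (take-++ y z)) (cong (blockClasses ns (T ∘ suc)) (drop-++ y z))

nbrSum-blockClasses : ∀ {r q a} (ns : Vec ℕ r) (T : (j : Fin r) → Word (lookup ns j) q → Fin a) (s : Fin r → ℕ) →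
  (∀ j y b → nbrsIn (T j) y b ≡ letterDist (T j y) b * s j) →
  ∀ x (g : Word r a → ℕ) → nbrSum x (g ∘ blockClasses ns T) ≡ ∑[ j < r ] (posNbrSum (blockClasses ns T x) g j * s j)
nbrSum-blockClasses []       T s T-eq [] g = refl
-- Matching on splitAt also rewrites blockClasses (n ∷ ns) T x to T zero y ∷ u in the goal.
nbrSum-blockClasses {suc r} {q} {a} (n ∷ ns) T s T-eq x g with splitAt n x
... | y , z , refl = begin
  nbrSum (y ++ z) (g ∘ blockClasses (n ∷ ns) T)
    ≡⟨ nbrSum-++ y z _ ⟩
  nbrSum y (λ y′ → g (blockClasses (n ∷ ns) T (y′ ++ z))) + nbrSum z (λ z′ → g (blockClasses (n ∷ ns) T (y ++ z′)))
    ≡⟨ cong₂ _+_ (nbrSum-cong y (λ y′ → cong g (blockClasses-++ n ns T y′ z)))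
                 (nbrSum-cong z (λ z′ → cong g (blockClasses-++ n ns T y z′))) ⟩
  nbrSum y (λ y′ → g (T zero y′ ∷ u)) + nbrSum z (λ z′ → g (T zero y ∷ blockClasses ns (T ∘ suc) z′))
    ≡⟨ cong₂ _+_ firstBlock (nbrSum-blockClasses ns (T ∘ suc) (s ∘ suc) (T-eq ∘ suc) z (g ∘ (T zero y ∷_))) ⟩
  ∑[ j < suc r ] (posNbrSum (T zero y ∷ u) g j * s j) ∎
  where
  open ≡-Reasoning
  u : Word r a
  u = blockClasses ns (T ∘ suc) z
  firstBlock : nbrSum y (λ y′ → g (T zero y′ ∷ u)) ≡ posNbrSum (T zero y ∷ u) g zero * s zero
  firstBlock = begin
    nbrSum y (λ y′ → g (T zero y′ ∷ u))
      ≡⟨ nbrSum-∘ (T zero) (λ b → g (b ∷ u)) y ⟩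
    ∑[ b < a ] (nbrsIn (T zero) y b * g (b ∷ u))
      ≡⟨ sum-cong-≗ (λ b → trans (cong (_* g (b ∷ u)) (T-eq zero y b))
                                 (xy∙z≈xz∙y (letterDist (T zero y) b) (s zero) (g (b ∷ u)))) ⟩
    ∑[ b < a ] (letterDist (T zero y) b * g (b ∷ u) * s zero)
      ≡⟨ *-distribʳ-sum (s zero) (λ b → letterDist (T zero y) b * g (b ∷ u)) ⟨
    posNbrSum (T zero y ∷ u) g zero * s zero ∎

module PositionCounts {r q k} (C : Word r q → Fin k) where

  posCount : Word r q → Fin k → Fin r → ℕ
  posCount v l = posNbrSum v (λ u → ⟦ does (C u ≟ l) ⟧)

  ∑-posCount : ∀ v l → ∑[ p < r ] posCount v l p ≡ nbrsIn C v l
  ∑-posCount v l = sym (trans (nbrsIn≡nbrSum C v l) (nbrSum≡∑posNbrSum v _))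

  ∑-posCount-classes : ∀ v p → ∑[ l < k ] posCount v l p ≡ q ∸ 1
  ∑-posCount-classes v p = begin
    ∑[ l < k ] ∑[ b < q ] (letterDist a b * ⟦ does (C (v [ p ]≔ b) ≟ l) ⟧)
      ≡⟨ ∑-comm (λ l b → letterDist a b * ⟦ does (C (v [ p ]≔ b) ≟ l) ⟧) ⟩
    ∑[ b < q ] ∑[ l < k ] (letterDist a b * ⟦ does (C (v [ p ]≔ b) ≟ l) ⟧)
      ≡⟨ sum-cong-≗ (λ b → trans (sym (*-distribˡ-sum (letterDist a b) (λ l → ⟦ does (C (v [ p ]≔ b) ≟ l) ⟧)))
                             (trans (cong (letterDist a b *_) (∑-⟦≟⟧ (C (v [ p ]≔ b)))) (*-identityʳ _))) ⟩
    ∑[ b < q ] letterDist a b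
      ≡⟨ ∑-letterDist a ⟩
    q ∸ 1 ∎
    where
    open ≡-Reasoning
    a : Fin q
    a = lookup v p

  lineCount : Word r q → Fin r → Fin k → ℕ
  lineCount v p l = ∑[ b < q ] ⟦ does (C (v [ p ]≔ b) ≟ l) ⟧

  lineCount≡posCount+⟦≟⟧ : ∀ v p l → lineCount v p l ≡ posCount v l p + ⟦ does (C v ≟ l) ⟧
  lineCount≡posCount+⟦≟⟧ v p l = begin
    ∑[ b < q ] inLine b
      ≡⟨ sum-cong-≗ (λ b → letterDist-+-⟦≟⟧ a b (inLine b)) ⟨
    ∑[ b < q ] (letterDist a b * inLine b + ⟦ does (a ≟ b) ⟧ * inLine b)
      ≡⟨ ∑-distrib-+ (λ b → letterDist a b * inLine b) (λ b → ⟦ does (a ≟ b) ⟧ * inLine b) ⟩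
    posCount v l p + ∑[ b < q ] (⟦ does (a ≟ b) ⟧ * inLine b)
      ≡⟨ cong (posCount v l p +_) (∑-select a inLine) ⟩
    posCount v l p + inLine a
      ≡⟨ cong (λ w → posCount v l p + ⟦ does (C w ≟ l) ⟧) ([]≔-lookup v p) ⟩
    posCount v l p + ⟦ does (C v ≟ l) ⟧ ∎
    where
    open ≡-Reasoning
    a : Fin q
    a = lookup v p
    inLine : Fin q → ℕ
    inLine b = ⟦ does (C (v [ p ]≔ b) ≟ l) ⟧

  IndependentClass : Fin k → Set
  IndependentClass l = ∀ w → C w ≡ l → nbrsIn C w l ≡ 0

  -- The line {v [ p ]≔ b : b} is a clique, so an independent class meets it at most once.
  lineCount≤1 : ∀ {l} → IndependentClass l → ∀ v p → lineCount v p l ≤ 1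
  lineCount≤1 {l} indep v p = ∑-⟦⟧≤1 (λ b → C (v [ p ]≔ b) ≟ l) unique
    where
    unique : ∀ b b′ → C (v [ p ]≔ b) ≡ l → C (v [ p ]≔ b′) ≡ l → b ≡ b′
    unique b b′ Cb Cb′ with b ≟ b′
    ... | yes b≡b′ = b≡b′
    ... | no  b≢b′ = ⊥-elim (1+n≢0 (trans (sym term≡1) term≡0))
      where
      w : Word r q
      w = v [ p ]≔ b
      term≡0 : letterDist (lookup w p) b′ * ⟦ does (C (w [ p ]≔ b′) ≟ l) ⟧ ≡ 0
      term≡0 = ∑≡0⇒≡0 _ (∑≡0⇒≡0 (posCount w l) (trans (∑-posCount w l) (indep w Cb)) p) b′
      term≡1 : letterDist (lookup w p) b′ * ⟦ does (C (w [ p ]≔ b′) ≟ l) ⟧ ≡ 1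
      term≡1 = cong₂ _*_ (trans (cong (λ c → letterDist c b′) (lookup∘update p v b)) (letterDist-≢ b≢b′))
                         (trans (cong (λ x → ⟦ does (C x ≟ l) ⟧) ([]≔-idempotent v p))
                                (cong ⟦_⟧ (dec-true (C _ ≟ l) Cb′)))

  posCount≤letterDist : ∀ {l} → IndependentClass l → ∀ v p → posCount v l p ≤ letterDist (C v) l
  posCount≤letterDist {l} indep v p with C v ≟ l | subst (_≤ 1) (lineCount≡posCount+⟦≟⟧ v p l) (lineCount≤1 indep v p)
  ... | yes _ | posCount+1≤1 = +-cancelʳ-≤ 1 (posCount v l p) 0 posCount+1≤1
  ... | no  _ | posCount+0≤1 = subst (_≤ 1) (+-identityʳ (posCount v l p)) posCount+0≤1

  module _ (L : Fin k → Fin k → ℕ) (C-eq : ∀ v l → nbrsIn C v l ≡ r * L (C v) l) where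

    posCount-indicatorColumn : ∀ l → (∀ i → L i l ≡ letterDist i l) → ∀ v p → posCount v l p ≡ L (C v) l
    posCount-indicatorColumn l column v = ∑-tight (posCount v l) (L (C v) l) bound (trans (∑-posCount v l) (C-eq v l))
      where
      independent : IndependentClass l
      independent w refl = trans (C-eq w l) (trans (cong (r *_) (trans (column l) (letterDist-refl l))) (*-zeroʳ r))
      bound : ∀ p → posCount v l p ≤ L (C v) l
      bound p = subst (posCount v l p ≤_) (sym (column (C v))) (posCount≤letterDist independent v p)

    posCount-uniform : (∀ i → ∑[ l < k ] L i l ≡ q ∸ 1) →
      ∃[ l₀ ] (∀ l → l ≢ l₀ → ∀ i → L i l ≡ letterDist i l) →
      ∀ v l p → posCount v l p ≡ L (C v) l
    posCount-uniform rows (l₀ , columns) v l p with l ≟ l₀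
    ... | no  l≢l₀ = posCount-indicatorColumn l (columns l l≢l₀) v p
    ... | yes refl = ∑-determines-entry (λ l → posCount v l p) (L (C v)) l₀
                       (λ l l≢l₀ → posCount-indicatorColumn l (columns l l≢l₀) v p)
                       (trans (∑-posCount-classes v p) (sym (rows (C v))))

∑-/-∣ : ∀ {r} d .{{_ : NonZero d}} (ns : Vec ℕ r) → (∀ j → d ∣ lookup ns j) →
        ∑[ j < r ] (lookup ns j / d) ≡ sum ns / d
∑-/-∣ d []       d∣ns = sym (0/n≡0 d)
∑-/-∣ d (n ∷ ns) d∣ns = trans (cong (n / d +_) (∑-/-∣ d ns (d∣ns ∘ suc))) (sym (+-distrib-/-∣ˡ (sum ns) (d∣ns zero)))

Smat-scale : ∀ {k} → k ≡ 2 ⊎ k ≡ 3 ⊎ k ≡ 4 → ∀ m i l → Smat k m i l ≡ Smat k 3 i l * (m / 3)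
Smat-scale (inj₁ refl)        m zero             zero             = refl
Smat-scale (inj₁ refl)        m zero             (suc zero)       = refl
Smat-scale (inj₁ refl)        m (suc zero)       zero             = sym (+-identityʳ (m / 3))
Smat-scale (inj₁ refl)        m (suc zero)       (suc zero)       = refl
Smat-scale (inj₂ (inj₁ refl)) m zero             zero             = refl
Smat-scale (inj₂ (inj₁ refl)) m zero             (suc zero)       = sym (+-identityʳ (m / 3))
Smat-scale (inj₂ (inj₁ refl)) m zero             (suc (suc zero)) = refl
Smat-scale (inj₂ (inj₁ refl)) m (suc zero)       zero             = sym (+-identityʳ (m / 3))
Smat-scale (inj₂ (inj₁ refl)) m (suc zero)       (suc zero)       = refl
Smat-scale (inj₂ (inj₁ refl)) m (suc zero)       (suc (suc zero)) = refl
Smat-scale (inj₂ (inj₁ refl)) m (suc (suc zero)) zero             = sym (+-identityʳ (m / 3))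
Smat-scale (inj₂ (inj₁ refl)) m (suc (suc zero)) (suc zero)       = sym (+-identityʳ (m / 3))
Smat-scale (inj₂ (inj₁ refl)) m (suc (suc zero)) (suc (suc zero)) = sym (+-identityʳ (m / 3))
Smat-scale (inj₂ (inj₂ refl)) m i                l with i ≟ l
... | yes _ = refl
... | no  _ = sym (+-identityʳ (m / 3))

Smat₃-rows : ∀ {k} → k ≡ 2 ⊎ k ≡ 3 ⊎ k ≡ 4 → ∀ i → ∑[ l < k ] Smat k 3 i l ≡ 3
Smat₃-rows (inj₁ refl)        zero             = refl
Smat₃-rows (inj₁ refl)        (suc zero)       = refl
Smat₃-rows (inj₂ (inj₁ refl)) zero             = refl
Smat₃-rows (inj₂ (inj₁ refl)) (suc zero)       = refl
Smat₃-rows (inj₂ (inj₁ refl)) (suc (suc zero)) = refl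
Smat₃-rows (inj₂ (inj₂ refl)) i                = ∑-letterDist i

Smat₃-indicatorColumns : ∀ {k} → k ≡ 2 ⊎ k ≡ 3 ⊎ k ≡ 4 →
  ∃[ l₀ ] (∀ l → l ≢ l₀ → ∀ i → Smat k 3 i l ≡ letterDist i l)
Smat₃-indicatorColumns (inj₁ refl)        = suc zero , columns
  where
  columns : ∀ l → l ≢ suc zero → ∀ i → S2 3 i l ≡ letterDist i l
  columns zero       _   zero       = refl
  columns zero       _   (suc zero) = refl
  columns (suc zero) l≢1 _          = ⊥-elim (l≢1 refl)
Smat₃-indicatorColumns (inj₂ (inj₁ refl)) = suc (suc zero) , columns
  where
  columns : ∀ l → l ≢ suc (suc zero) → ∀ i → S3 3 i l ≡ letterDist i l
  columns zero             _   zero             = refl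
  columns zero             _   (suc zero)       = refl
  columns zero             _   (suc (suc zero)) = refl
  columns (suc zero)       _   zero             = refl
  columns (suc zero)       _   (suc zero)       = refl
  columns (suc zero)       _   (suc (suc zero)) = refl
  columns (suc (suc zero)) l≢2 _                = ⊥-elim (l≢2 refl)
Smat₃-indicatorColumns (inj₂ (inj₂ refl)) = zero , λ _ _ _ → refl

S4-equitable⇒letterDist : ∀ {n q} (c : Word n q → Fin 4) → IsEquitable n q 4 c (Smat 4 n) →
  ∀ y b → nbrsIn c y b ≡ letterDist (c y) b * (n / 3)
S4-equitable⇒letterDist {n} c c-eq y b = trans (c-eq (c y) b y refl) (Smat-scale (inj₂ (inj₂ refl)) n (c y) b)

equitable-Smat-rescale : ∀ {r q k} → k ≡ 2 ⊎ k ≡ 3 ⊎ k ≡ 4 → (C : Word r q → Fin k) →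
  IsEquitable r q k C (Smat k (3 * r)) → ∀ v l → nbrsIn C v l ≡ r * Smat k 3 (C v) l
equitable-Smat-rescale {r} {k = k} k∈234 C C-eq v l = begin
  nbrsIn C v l                        ≡⟨ C-eq (C v) l v refl ⟩
  Smat k (3 * r) (C v) l              ≡⟨ Smat-scale k∈234 (3 * r) (C v) l ⟩
  Smat k 3 (C v) l * (3 * r / 3)      ≡⟨ cong (λ m → Smat k 3 (C v) l * (m / 3)) (*-comm 3 r) ⟩
  Smat k 3 (C v) l * (r * 3 / 3)      ≡⟨ cong (Smat k 3 (C v) l *_) (m*n/n≡m r 3) ⟩
  Smat k 3 (C v) l * r                ≡⟨ *-comm _ r ⟩
  r * Smat k 3 (C v) l                ∎
  where open ≡-Reasoning

theorem3 : (r : ℕ) → 1 ≤ r → (k : ℕ) → (k ≡ 2 ⊎ k ≡ 3 ⊎ k ≡ 4) →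
    (ns : Vec ℕ r) → (∀ j → 0 < lookup ns j) → (∀ j → 3 ∣ lookup ns j) →
    (T : (j : Fin r) → Word (lookup ns j) 2 → Fin 4) →
    (∀ j → IsEquitable (lookup ns j) 2 4 (T j) (Smat 4 (lookup ns j))) →
    (C : Word r 4 → Fin k) → IsEquitable r 4 k C (Smat k (3 * r)) →
    IsEquitable (sum ns) 2 k (liftPartition ns T C) (Smat k (sum ns))
theorem3 r _ k k∈234 ns _ 3∣ns T T-eq C C-eq _ l x refl = begin
  nbrsIn (liftPartition ns T C) x l
    ≡⟨ nbrsIn≡nbrSum (liftPartition ns T C) x l ⟩
  nbrSum x (classIndicator ∘ blockClasses ns T)
    ≡⟨ nbrSum-blockClasses ns T (λ j → lookup ns j / 3) (λ j → S4-equitable⇒letterDist (T j) (T-eq j)) x classIndicator ⟩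
  ∑[ j < r ] (posCount v l j * (lookup ns j / 3))
    ≡⟨ sum-cong-≗ (λ j → cong (_* (lookup ns j / 3)) (uniform j)) ⟩
  ∑[ j < r ] (Smat k 3 (C v) l * (lookup ns j / 3))
    ≡⟨ *-distribˡ-sum (Smat k 3 (C v) l) (λ j → lookup ns j / 3) ⟨
  Smat k 3 (C v) l * ∑[ j < r ] (lookup ns j / 3)
    ≡⟨ cong (Smat k 3 (C v) l *_) (∑-/-∣ 3 ns 3∣ns) ⟩
  Smat k 3 (C v) l * (sum ns / 3)
    ≡⟨ Smat-scale k∈234 (sum ns) (C v) l ⟨
  Smat k (sum ns) (C v) l ∎
  where
  open ≡-Reasoning
  open PositionCounts C
  v : Word r 4
  v = blockClasses ns T x
  classIndicator : Word r 4 → ℕ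
  classIndicator u = ⟦ does (C u ≟ l) ⟧
  uniform : ∀ j → posCount v l j ≡ Smat k 3 (C v) l
  uniform = posCount-uniform (Smat k 3) (equitable-Smat-rescale k∈234 C C-eq)
              (Smat₃-rows k∈234) (Smat₃-indicatorColumns k∈234) v l
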